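{- Let $G$ be the path graph on vertices $v_1,\ldots,v_n$ (in this order), let $k\geq2$ and $n\geq k+2$, and let $L\subseteq V$ with $|L|=k$. If $L$ induces at least two gaps and at least one of these gaps has at least two vertices, then $L$ is not an NL-landmark set for parameter $k$.
   Context: $d(x,y)$ denotes the graph distance. A vertex $\tau$ separates distinct vertices $u,v$ if $d(u,\tau)\neq d(v,\tau)$. A set $L\subseteq V$ is an NL-landmark set for parameter $k$ if every pair of distinct vertices $u,v\in V\setminus L$ is separated by at least $k$ distinct vertices of $L$. Given $L$, a hole is a vertex of $V\setminus L$, and a gap is a maximal sequence of consecutive holes along the path; its length is its number of vertices. -}

module Defs where

open import Data.Nat using (ℕ; zero; suc; _≤_; _<_; _≡ᵇ_; ∣_-_∣; _+_)
open import Data.Fin using (Fin; toℕ)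
open import Data.Fin.Subset using (Subset; _∈_; _∉_; _∩_; ∣_∣)
open import Data.Vec using (tabulate)
open import Data.Bool using (not)
open import Data.Product using (_×_; ∃-syntax)
open import Data.Sum using (_⊎_)
open import Relation.Binary.PropositionalEquality using (_≡_)
open import Relation.Nullary using (¬_)

-- The path graph P_n: vertex v_{i+1} is represented by i : Fin n,
-- consecutive vertices adjacent.  Its graph distance is |i - j|.
pathDist : {n : ℕ} → Fin n → Fin n → ℕ
pathDist i j = ∣ toℕ i - toℕ j ∣

separators : {n : ℕ} → Fin n → Fin n → Subset n
separators u v = tabulate (λ τ → not (pathDist u τ ≡ᵇ pathDist v τ))

IsNLLandmark : {n : ℕ} → ℕ → Subset n → Set
IsNLLandmark k L =
  ∀ u v → u ≢ v → u ∉ L → v ∉ L → k ≤ ∣ L ∩ separators u v ∣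
  where
  _≢_ : {A : Set} → A → A → Set
  x ≢ y = ¬ (x ≡ y)

-- A gap of L: a maximal run of consecutive holes, given by the indices
-- a ≤ b (0-based) of its first and last vertex; its length is b - a + 1.
record Gap {n : ℕ} (L : Subset n) (a b : ℕ) : Set where
  field
    a≤b      : a ≤ b
    b<n      : b < n
    allHoles : (i : Fin n) → a ≤ toℕ i → toℕ i ≤ b → i ∉ L
    leftMax  : a ≡ 0 ⊎ ∃[ j ] (suc (toℕ j) ≡ a × j ∈ L)
    rightMax : suc b ≡ n ⊎ ∃[ j ] (toℕ j ≡ suc b × j ∈ L)

module Submission where

-- Call the vertices of L marks and the others holes.  If two
-- distinct holes u, v are at equal distance from a mark t, then t does not
-- separate them, so at most |L| - 1 = k - 1 marks do and L fails.  Such a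
-- triple exists: a gap with two vertices ends, say on its right, in holes
-- p, p+1 followed by the mark p+2, and a second gap supplies a further hole
-- beyond.  Let c be the first hole after p+1; the vertices p+2, ..., c-1 are
-- marks, and one of p, p+1 has the same parity as c, so the midpoint of it
-- and c is one of these marks.

open import Defs
open import Data.Nat using (ℕ; _≤_; _+_; suc)
open import Data.Fin.Subset using (Subset; ∣_∣)
open import Data.Product using (_×_; ∃-syntax)
open import Data.Sum using (_⊎_)
open import Relation.Binary.PropositionalEquality using (_≡_)
open import Relation.Nullary using (¬_)

open import Data.Nat using (zero; _<_; _∸_; ∣_-_∣; _≡ᵇ_; z≤n; s≤s)
open import Data.Nat.Properties
open import Data.Fin using (Fin; toℕ; fromℕ<)
open import Data.Fin.Properties using (toℕ-fromℕ<; toℕ-injective)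
open import Data.Fin.Subset using (_∈_; _∉_; _∩_; _⊂_)
open import Data.Fin.Subset.Properties using (_∈?_; p∩q⊆p; x∈p∩q⁻; p⊂q⇒∣p∣<∣q∣)
open import Data.Vec.Properties using ([]=⇒lookup; lookup∘tabulate)
open import Data.Bool using (true; false)
open import Data.Product using (Σ; _,_; proj₂)
open import Data.Sum using (inj₁; inj₂)
open import Data.Empty using (⊥; ⊥-elim)
open import Function using (_∘_)
open import Relation.Nullary using (yes; no)
open import Relation.Binary using (tri<; tri≈; tri>)
open import Relation.Binary.PropositionalEquality using (refl; sym; trans; cong; cong₂; subst; module ≡-Reasoning)

unseparated : ∀ {n} (u v t : Fin n) → pathDist u t ≡ pathDist v t → t ∉ separators u v
unseparated u v t eq t∈sep
  with pathDist u t ≡ᵇ pathDist v t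
     | ≡⇒≡ᵇ (pathDist u t) (pathDist v t) eq
     | trans (sym (lookup∘tabulate _ t)) ([]=⇒lookup t∈sep)
... | false | () | _
... | true  | _  | ()

-- The counting argument: a mark equidistant from two distinct holes leaves
-- at most |L| - 1 separating marks for them.
equidistant⇒¬NL : ∀ {n k} {L : Subset n} → ∣ L ∣ ≡ k → (u v t : Fin n) →
  ¬ (u ≡ v) → u ∉ L → v ∉ L → t ∈ L → pathDist u t ≡ pathDist v t → ¬ IsNLLandmark k L
equidistant⇒¬NL {L = L} refl u v t u≢v u∉L v∉L t∈L eq isNL =
  <⇒≱ (p⊂q⇒∣p∣<∣q∣ separatorsMissT) (isNL u v u≢v u∉L v∉L)
  where
  separatorsMissT : (L ∩ separators u v) ⊂ L
  separatorsMissT = p∩q⊆p L _ , t , t∈L ,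
    λ t∈∩ → unseparated u v t eq (proj₂ (x∈p∩q⁻ L _ t∈∩))

midpoint : ∀ c → 3 ≤ c → ∃[ u ] ∃[ e ] (u ≤ 1 × 2 ≤ u + suc e × u + suc e + suc e ≡ c)
midpoint 3 _ = 1 , 0 , s≤s z≤n , ≤-refl , refl
midpoint 4 _ = 0 , 1 , z≤n , ≤-refl , refl
midpoint 1 (s≤s ())
midpoint 2 (s≤s (s≤s ()))
midpoint (suc (suc c@(suc (suc (suc _))))) _ with midpoint c (s≤s (s≤s (s≤s z≤n)))
... | u , e , u≤1 , 2≤t , eq =
  u , suc e , u≤1 , ≤-trans 2≤t (+-monoʳ-≤ u (n≤1+n (suc e))) , widen
  where
  open ≡-Reasoning
  widen : u + suc (suc e) + suc (suc e) ≡ suc (suc c)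
  widen = begin
    u + suc (suc e) + suc (suc e)   ≡⟨ cong (_+ suc (suc e)) (+-suc u (suc e)) ⟩
    suc (u + suc e + suc (suc e))   ≡⟨ cong suc (+-suc (u + suc e) (suc e)) ⟩
    suc (suc (u + suc e + suc e))   ≡⟨ cong (suc ∘ suc) eq ⟩
    suc (suc c)                     ∎

module MirrorSearch (Hole Mark : ℕ → Set) where

  MarksBelow : ℕ → Set
  MarksBelow c = ∀ j → 2 ≤ j → j < c → Mark j

  record Mirror (h : ℕ) : Set where
    field
      u e         : ℕ
      leftHole    : Hole u
      centreMark  : Mark (u + suc e)
      rightHole   : Hole (u + suc e + suc e)
      withinRange : u + suc e + suc e ≤ h

  scan : ∀ d → (∀ i → i < 3 + d → Hole i ⊎ Mark i) → Mark 2 →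
         MarksBelow (3 + d) ⊎ ∃[ c ] (3 ≤ c × c < 3 + d × Hole c × MarksBelow c)
  scan zero _ mark₂ = inj₁ onlyTwo
    where
    onlyTwo : MarksBelow 3
    onlyTwo 2 _ _ = mark₂
    onlyTwo 1 (s≤s ()) _
    onlyTwo (suc (suc (suc _))) _ (s≤s (s≤s (s≤s ())))
  scan (suc d) label mark₂ with scan d (λ i i< → label i (m≤n⇒m≤1+n i<)) mark₂
  ... | inj₂ (c , 3≤c , c< , hole , marks) = inj₂ (c , 3≤c , m≤n⇒m≤1+n c< , hole , marks)
  ... | inj₁ marks with label (3 + d) ≤-refl
  ...   | inj₁ hole = inj₂ (3 + d , s≤s (s≤s (s≤s z≤n)) , ≤-refl , hole , marks)
  ...   | inj₂ mark = inj₁ extended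
    where
    extended : MarksBelow (4 + d)
    extended j 2≤j (s≤s j≤) with m≤n⇒m<n∨m≡n j≤
    ... | inj₁ j< = marks j 2≤j j<
    ... | inj₂ refl = mark

  firstHole : ∀ h → 3 ≤ h → (∀ i → i ≤ h → Hole i ⊎ Mark i) → Mark 2 → Hole h →
              ∃[ c ] (3 ≤ c × c ≤ h × Hole c × MarksBelow c)
  firstHole (suc (suc (suc d))) (s≤s (s≤s (s≤s z≤n))) label mark₂ hole
    with scan d (λ i i< → label i (<⇒≤ i<)) mark₂
  ... | inj₁ marks = 3 + d , s≤s (s≤s (s≤s z≤n)) , ≤-refl , hole , marks
  ... | inj₂ (c , 3≤c , c< , holeC , marks) = c , 3≤c , <⇒≤ c< , holeC , marks

  mirror : ∀ h → 3 ≤ h → (∀ i → i ≤ h → Hole i ⊎ Mark i) →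
           Hole 0 → Hole 1 → Mark 2 → Hole h → Mirror h
  mirror h 3≤h label hole₀ hole₁ mark₂ holeH with firstHole h 3≤h label mark₂ holeH
  ... | c , 3≤c , c≤h , holeC , marks with midpoint c 3≤c
  ...   | u , e , u≤1 , 2≤t , eq = record
    { u           = u
    ; e           = e
    ; leftHole    = start u≤1
    ; centreMark  = marks (u + suc e) 2≤t (subst (u + suc e <_) eq (m<m+n _ (s≤s z≤n)))
    ; rightHole   = subst Hole (sym eq) holeC
    ; withinRange = subst (_≤ h) (sym eq) c≤h
    }
    where
    start : ∀ {i} → i ≤ 1 → Hole i
    start z≤n = hole₀
    start (s≤s z≤n) = hole₁

reflect-dist : ∀ S x y → x ≤ S → y ≤ S → ∣ S ∸ x - S ∸ y ∣ ≡ ∣ x - y ∣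
reflect-dist S zero zero _ _ = ∣n-n∣≡0 S
reflect-dist (suc S) (suc x) (suc y) (s≤s x≤S) (s≤s y≤S) = reflect-dist S x y x≤S y≤S
reflect-dist (suc S) zero (suc y) _ (s≤s y≤S) =
  trans (m≤n⇒∣n-m∣≡n∸m (≤-trans (m∸n≤m S y) (n≤1+n S)))
        (trans (+-∸-assoc 1 (m∸n≤m S y)) (cong suc (m∸[m∸n]≡n y≤S)))
reflect-dist (suc S) (suc x) zero (s≤s x≤S) _ =
  trans (m≤n⇒∣m-n∣≡n∸m (≤-trans (m∸n≤m S x) (n≤1+n S)))
        (trans (+-∸-assoc 1 (m∸n≤m S x)) (cong suc (m∸[m∸n]≡n x≤S)))

shift-dist : ∀ s x y → ∣ x + s - y + s ∣ ≡ ∣ x - y ∣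
shift-dist s x y = trans (cong₂ ∣_-_∣ (+-comm x s) (+-comm y s)) (∣m+n-m+o∣≡∣n-o∣ s x y)

module OnPath {n : ℕ} (L : Subset n) where

  Hole Mark : ℕ → Set
  Hole i = Σ (Fin n) λ f → toℕ f ≡ i × f ∉ L
  Mark i = Σ (Fin n) λ f → toℕ f ≡ i × f ∈ L

  hole≢mark : ∀ {i} → Hole i → Mark i → ⊥
  hole≢mark (f , refl , f∉L) (g , g≡f , g∈L) with toℕ-injective g≡f
  ... | refl = f∉L g∈L

  label : ∀ {i} → i < n → Hole i ⊎ Mark i
  label i<n with fromℕ< i<n ∈? L
  ... | yes f∈L = inj₂ (fromℕ< i<n , toℕ-fromℕ< i<n , f∈L)
  ... | no  f∉L = inj₁ (fromℕ< i<n , toℕ-fromℕ< i<n , f∉L)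

  isometricMirror : ∀ {k} → ∣ L ∣ ≡ k → (φ : ℕ → ℕ) (h : ℕ) → 3 ≤ h →
    (∀ x y → x ≤ h → y ≤ h → ∣ φ x - φ y ∣ ≡ ∣ x - y ∣) → (∀ i → i ≤ h → φ i < n) →
    Hole (φ 0) → Hole (φ 1) → Mark (φ 2) → Hole (φ h) → ¬ IsNLLandmark k L
  isometricMirror |L|≡k φ h 3≤h iso inRange hole₀ hole₁ mark₂ holeH
    with MirrorSearch.mirror (Hole ∘ φ) (Mark ∘ φ) h 3≤h (λ i i≤h → label (inRange i i≤h))
           hole₀ hole₁ mark₂ holeH
  ... | record { u = u ; e = e ; leftHole = (fu , fu≡ , fu∉L) ; centreMark = (ft , ft≡ , ft∈L)
               ; rightHole = (fv , fv≡ , fv∉L) ; withinRange = v≤h } =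
    equidistant⇒¬NL |L|≡k fu fv ft distinct fu∉L fv∉L ft∈L
      (trans (cong₂ ∣_-_∣ fu≡ ft≡) (trans equidistant (sym (cong₂ ∣_-_∣ fv≡ ft≡))))
    where
    t v : ℕ
    t = u + suc e
    v = t + suc e
    t≤h : t ≤ h
    t≤h = ≤-trans (m≤m+n t (suc e)) v≤h
    u≤h : u ≤ h
    u≤h = ≤-trans (m≤m+n u (suc e)) t≤h
    -- the isometry is injective, and u < v
    distinct : ¬ (fu ≡ fv)
    distinct fu≡fv = <⇒≢ (≤-trans (m<m+n u (s≤s z≤n)) (m≤m+n t (suc e)))
      (∣m-n∣≡0⇒m≡n (trans (sym (iso u v u≤h v≤h)) (m≡n⇒∣m-n∣≡0 φu≡φv)))
      where
      φu≡φv : φ u ≡ φ v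
      φu≡φv = trans (sym fu≡) (trans (cong toℕ fu≡fv) fv≡)
    open ≡-Reasoning
    equidistant : ∣ φ u - φ t ∣ ≡ ∣ φ v - φ t ∣
    equidistant = begin
      ∣ φ u - φ t ∣  ≡⟨ iso u t u≤h t≤h ⟩
      ∣ u - t ∣      ≡⟨ ∣m-m+n∣≡n u (suc e) ⟩
      suc e          ≡⟨ sym (∣m-m+n∣≡n t (suc e)) ⟩
      ∣ t - v ∣      ≡⟨ ∣-∣-comm t v ⟩
      ∣ v - t ∣      ≡⟨ sym (iso v t v≤h t≤h) ⟩
      ∣ φ v - φ t ∣  ∎

  holeIn : ∀ {a b} → Gap L a b → ∀ {i} → a ≤ i → i ≤ b → Hole i
  holeIn {a} {b} g {i} a≤i i≤b = fromℕ< i<n , toℕ-fromℕ< i<n ,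
    Gap.allHoles g (fromℕ< i<n) (subst (a ≤_) (sym (toℕ-fromℕ< i<n)) a≤i)
                                (subst (_≤ b) (sym (toℕ-fromℕ< i<n)) i≤b)
    where
    i<n : i < n
    i<n = ≤-<-trans i≤b (Gap.b<n g)

  markBefore : ∀ {r b} → Gap L (suc r) b → Mark r
  markBefore g with Gap.leftMax g
  ... | inj₁ ()
  ... | inj₂ (j , 1+j≡1+r , j∈L) = j , suc-injective 1+j≡1+r , j∈L

  markAfter : ∀ {a b} → Gap L a b → suc b < n → Mark (suc b)
  markAfter g 1+b<n with Gap.rightMax g
  ... | inj₁ 1+b≡n = ⊥-elim (<-irrefl 1+b≡n 1+b<n)
  ... | inj₂ mark = mark

  laterGap : ∀ {a b a′ b′} → Gap L a b → Gap L a′ b′ → a < a′ → b < a′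
  laterGap {a} {b} {a′} g g′ a<a′ with a′ ≤? b
  ... | no a′≰b = ≰⇒> a′≰b
  ... | yes a′≤b with Gap.leftMax g′
  ...   | inj₁ refl = ⊥-elim (n≮0 a<a′)
  ...   | inj₂ (j , 1+j≡a′ , j∈L) = ⊥-elim (Gap.allHoles g j a≤j j≤b j∈L)
    where
    a≤j : a ≤ toℕ j
    a≤j = ≤-pred (subst (a <_) (sym 1+j≡a′) a<a′)
    j≤b : toℕ j ≤ b
    j≤b = ≤-trans (n≤1+n _) (subst (_≤ b) (sym 1+j≡a′) a′≤b)

  -- holes p, p + 1, the mark p + 2 and a hole q further right:
  -- shift [0, q - p] onto [p, q]
  pairThenHoleRight : ∀ {k p q} → ∣ L ∣ ≡ k → Hole p → Hole (suc p) → Mark (2 + p) →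
    Hole q → suc p < q → q < n → ¬ IsNLLandmark k L
  pairThenHoleRight {p = p} {q} |L|≡k hole₀ hole₁ mark₂ holeQ 1+p<q q<n =
    isometricMirror |L|≡k (_+ p) (q ∸ p) 3≤h (λ x y _ _ → shift-dist p x y) inRange
      hole₀ hole₁ mark₂ (subst Hole (sym (m∸n+n≡m p≤q)) holeQ)
    where
    p≤q : p ≤ q
    p≤q = ≤-trans (n≤1+n p) (<⇒≤ 1+p<q)
    3+p≤q : 3 + p ≤ q
    3+p≤q = ≤∧≢⇒< 1+p<q (λ 2+p≡q → hole≢mark (subst Hole (sym 2+p≡q) holeQ) mark₂)
    3≤h : 3 ≤ q ∸ p
    3≤h = subst (_≤ q ∸ p) (m+n∸n≡m 3 p) (∸-monoˡ-≤ p 3+p≤q)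
    inRange : ∀ i → i ≤ q ∸ p → i + p < n
    inRange i i≤h = ≤-<-trans (subst (i + p ≤_) (m∸n+n≡m p≤q) (+-monoˡ-≤ p i≤h)) q<n

  -- the mark r, holes r + 1, r + 2 and a hole q further left:
  -- reflect [0, r + 2 - q] onto [q, r + 2]
  pairThenHoleLeft : ∀ {k r q} → ∣ L ∣ ≡ k → Hole (2 + r) → Hole (suc r) → Mark r →
    Hole q → q ≤ r → 2 + r < n → ¬ IsNLLandmark k L
  pairThenHoleLeft {r = r} {q} |L|≡k hole₀ hole₁ mark₂ holeQ q≤r 2+r<n =
    isometricMirror |L|≡k (2 + r ∸_) h 3≤h iso (λ i _ → ≤-<-trans (m∸n≤m (2 + r) i) 2+r<n)
      hole₀ hole₁ mark₂ (subst Hole (sym (m∸[m∸n]≡n q≤2+r)) holeQ)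
    where
    h : ℕ
    h = 2 + r ∸ q
    q≤2+r : q ≤ 2 + r
    q≤2+r = ≤-trans q≤r (≤-trans (n≤1+n r) (n≤1+n (suc r)))
    q<r : q < r
    q<r = ≤∧≢⇒< q≤r (λ q≡r → hole≢mark (subst Hole q≡r holeQ) mark₂)
    3≤h : 3 ≤ h
    3≤h = subst (3 ≤_) (sym (+-∸-assoc 2 q≤r)) (+-monoʳ-≤ 2 (m<n⇒0<n∸m q<r))
    iso : ∀ x y → x ≤ h → y ≤ h → ∣ 2 + r ∸ x - 2 + r ∸ y ∣ ≡ ∣ x - y ∣
    iso x y x≤h y≤h = reflect-dist (2 + r) x y (≤-trans x≤h (m∸n≤m _ q)) (≤-trans y≤h (m∸n≤m _ q))

  longGap⇒¬NL : ∀ {k a b a′ b′} → ∣ L ∣ ≡ k → Gap L a b → Gap L a′ b′ → ¬ (a ≡ a′) →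
    suc a ≤ b → ¬ IsNLLandmark k L
  longGap⇒¬NL {a = a} {a′ = a′} |L|≡k g g′ a≢a′ (s≤s a≤p) with <-cmp a a′
  ... | tri≈ _ a≡a′ _ = ⊥-elim (a≢a′ a≡a′)
  ... | tri< a<a′ _ _ =
    pairThenHoleRight |L|≡k (holeIn g a≤p (n≤1+n _)) (holeIn g (m≤n⇒m≤1+n a≤p) ≤-refl)
      (markAfter g (≤-<-trans b<a′ a′<n)) (holeIn g′ ≤-refl (Gap.a≤b g′)) b<a′ a′<n
    where
    b<a′ : suc _ < a′
    b<a′ = laterGap g g′ a<a′
    a′<n : a′ < n
    a′<n = ≤-<-trans (Gap.a≤b g′) (Gap.b<n g′)
  ... | tri> _ _ (s≤s a′≤r) =
    pairThenHoleLeft |L|≡k (holeIn g (n≤1+n _) (s≤s a≤p)) (holeIn g ≤-refl (m≤n⇒m≤1+n a≤p))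
      (markBefore g) (holeIn g′ ≤-refl (Gap.a≤b g′)) a′≤r (≤-<-trans (s≤s a≤p) (Gap.b<n g))

mainTheorem4 : (n k : ℕ) → 2 ≤ k → k + 2 ≤ n → (L : Subset n) → ∣ L ∣ ≡ k →
    (∃[ a₁ ] ∃[ b₁ ] ∃[ a₂ ] ∃[ b₂ ]
      (Gap L a₁ b₁ × Gap L a₂ b₂ × ¬ (a₁ ≡ a₂) × (suc a₁ ≤ b₁ ⊎ suc a₂ ≤ b₂))) →
    ¬ IsNLLandmark k L
mainTheorem4 n k _ _ L |L|≡k (_ , _ , _ , _ , g₁ , g₂ , a₁≢a₂ , inj₁ long₁) =
  OnPath.longGap⇒¬NL L |L|≡k g₁ g₂ a₁≢a₂ long₁
mainTheorem4 n k _ _ L |L|≡k (_ , _ , _ , _ , g₁ , g₂ , a₁≢a₂ , inj₂ long₂) =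
  OnPath.longGap⇒¬NL L |L|≡k g₂ g₁ (a₁≢a₂ ∘ sym) long₂
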